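{- Let $d$ and $k$ be positive integers, and let $A,B\subseteq\mathcal{S}_k\cup\{(0,\dots,0)\}$. Suppose that for every $b=(b_1,\dots,b_d)\in B$ there is a family of subsets of $[k]$ defined inductively as follows: $R_{d;b}\subseteq[k]$ with $|R_{d;b}|=b_d$; for each $n_d\in[k]\setminus R_{d;b}$, a set $R_{d-1;n_d;b}\subseteq[k]$ with $|R_{d-1;n_d;b}|=b_{d-1}$; for each $n_{d-1}\notin R_{d-1;n_d;b}$ and $n_d\notin R_{d;b}$, a set $R_{d-2;n_{d-1},n_d;b}\subseteq[k]$ with $|R_{d-2;n_{d-1},n_d;b}|=b_{d-2}$; and so on, until for $n_2\notin R_{2;n_3,\dots,n_d;b},\dots,n_d\notin R_{d;b}$, a set $R_{1;n_2,\dots,n_d;b}\subseteq[k]$ with $|R_{1;n_2,\dots,n_d;b}|=b_1$. Suppose moreover that whenever $a=(a_1,\dots,a_d)\in A$ and $b\in B$ satisfy $a_d\notin R_{d;b}$, $a_{d-1}\notin R_{d-1;a_d;b}$, $\dots$, $a_2\notin R_{2;a_3,\dots,a_d;b}$, we have $a_1\in R_{1;a_2,\dots,a_d;b}$. Then $$|A|\le n_d(k)+1-|B_k^+|.$$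
   Context: $[k]=\{0,1,\dots,k\}$. $\mathcal{S}_k=\{a\in\mathbb{Z}_{\ge0}^d:1\le|a|\le k\}$ with $|a|=a_1+\dots+a_d$, and $n_d(k)=|\mathcal{S}_k|=\binom{d+k}{k}-1$. For $d$-tuples, $b\preceq a$ means $b_i\le a_i$ for all $i$. $B_k^+=\{a\in\mathcal{S}_k:\exists b\in B\text{ with }b\preceq a\}$. -}

module Defs where

open import Data.Nat using (ℕ; zero; suc; _+_; _∸_; _≤_; _≤?_)
open import Data.Nat.Combinatorics using (_C_)
open import Data.Vec using (Vec; []; _∷_; last; init; head; replicate)
open import Data.Vec as V using ()
open import Data.List using (List; []; _∷_; map; concatMap; upTo; filter; length)
open import Data.List.Relation.Unary.All using (All)
open import Data.List.Relation.Unary.Any using (any?)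
open import Data.List.Relation.Unary.Unique.Propositional using (Unique)
open import Data.List.Membership.Propositional using (_∈_; _∉_)
open import Data.Vec.Relation.Binary.Pointwise.Inductive using (Pointwise; decidable)
open import Data.Product using (Σ; _×_)
open import Data.Sum using (_⊎_)
open import Relation.Binary.PropositionalEquality using (_≡_)
open import Relation.Nullary.Decidable using (_×-dec_)

∣_∣ᵥ : ∀ {d} → Vec ℕ d → ℕ
∣ a ∣ᵥ = V.sum a

InS : ∀ {d} → ℕ → Vec ℕ d → Set
InS k a = 1 ≤ ∣ a ∣ᵥ × ∣ a ∣ᵥ ≤ k

InS0 : ∀ {d} → ℕ → Vec ℕ d → Set
InS0 {d} k a = InS k a ⊎ a ≡ replicate d 0

nd : ℕ → ℕ → ℕ
nd d k = ((d + k) C k) ∸ 1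

_⪯_ : ∀ {d} → Vec ℕ d → Vec ℕ d → Set
b ⪯ a = Pointwise _≤_ b a

allVecs : (d k : ℕ) → List (Vec ℕ d)
allVecs zero k = [] ∷ []
allVecs (suc d) k = concatMap (λ x → map (x ∷_) (allVecs d k)) (upTo (suc k))

Sk : (d k : ℕ) → List (Vec ℕ d)
Sk d k = filter (λ a → (1 ≤? ∣ a ∣ᵥ) ×-dec (∣ a ∣ᵥ ≤? k)) (allVecs d k)

Bplus : (d k : ℕ) → List (Vec ℕ d) → List (Vec ℕ d)
Bplus d k B = filter (λ a → any? (λ b → decidable _≤?_ b a) B) (Sk d k)

-- a subset of [k] = {0,…,k} of cardinality m (duplicate-free list)
SubsetOfSize : (k m : ℕ) → Set
SubsetOfSize k m = Σ (List ℕ) λ R → Unique R × All (_≤ k) R × length R ≡ m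

elems : ∀ {k m} → SubsetOfSize k m → List ℕ
elems (R Data.Product., _) = R

-- The inductive family of sets R_{i; n_{i+1},…,n_d; b} for b in dimension (suc d):
-- R_{d;b} of size b_d (the last coordinate), and for each n_d ∈ [k] \ R_{d;b}
-- a family for (b_1,…,b_{d-1}); in dimension 1 just R_{1;…;b} of size b_1.
Family : (k d : ℕ) → Vec ℕ (suc d) → Set
Family k zero b = SubsetOfSize k (head b)
Family k (suc d) b =
  Σ (SubsetOfSize k (last b)) λ R →
    (n : ℕ) → n ≤ k → n ∉ elems R → Family k d (init b)

Good : (k d : ℕ) (b : Vec ℕ (suc d)) → Family k d b → Vec ℕ (suc d) → Set
Good k zero b R a = head a ∈ elems R
Good k (suc d) b (R Data.Product., f) a =
  (le : last a ≤ k) (p : last a ∉ elems R) → Good k d (init b) (f (last a) le p) (init a)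

{-# OPTIONS --safe #-}
module Submission where

-- Fix a cap S on the weight |a|. Slicing along the last coordinate, the families R_{…;n;b} with
-- n ∉ R_{d;b} form an instance of the same problem one dimension lower, with cap S − n. By induction on d,
-- A has at most as many points as the set U_S of points of weight < S lying above no vector of B.
-- In dimension one, every point of A lies in each R_{1;b}, so A has at most min(S, b_1 : b ∈ B) points,
-- which is exactly the size of U_S. In the inductive step, after exchanging the order of summation, the
-- values n for which x is uncovered in the n-th slice all lie in every R_{d;b} with (b_1,…,b_{d-1}) ⪯ x,
-- so the same one-dimensional count compares them with the fibre of U_S over x. Finally U_{k+1} and
-- B_k^+ are disjoint sets of points of weight ≤ k, of which there are C(d+k, k) = n_d(k) + 1.

open import Defs
open import Data.Nat using (ℕ; zero; suc; _+_; _∸_; _≤_; _<_; _⊓_; z≤n; s≤s; s≤s⁻¹; z<s; s<s; _≤?_; _<?_; _≟_)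
open import Data.Nat.Properties
open import Data.Nat.Combinatorics using (_C_; nCn≡1; nCk+nC[k+1]≡[n+1]C[k+1])
open import Data.Nat.ListAction using (sum)
open import Data.Nat.ListAction.Properties using (sum-++)
open import Data.Fin using (toℕ)
import Algebra.Properties.CommutativeMonoid.Sum +-0-commutativeMonoid as ∑
open import Data.Vec using (Vec; []; _∷_; _∷ʳ_; init; last; head; initLast; replicate)
open import Data.Vec.Properties using (init-∷ʳ; last-∷ʳ; ≡-dec)
open import Data.Vec.Relation.Binary.Pointwise.Inductive using ([]; _∷_; decidable)
open import Data.List using (List; []; _∷_; length; map; filter; applyUpTo; concatMap; _++_)
open import Data.List.Properties using (map-++; map-∘)
open import Data.List.Relation.Unary.All as All using (All; []; _∷_; all?)
open import Data.List.Relation.Unary.All.Properties using (map⁺; map⁻; All¬⇒¬Any)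
open import Data.List.Relation.Unary.Any using (Any; here; there; any?)
open import Data.List.Relation.Unary.AllPairs using (_∷_)
open import Data.List.Relation.Unary.Unique.Propositional using (Unique)
open import Data.List.Membership.Propositional using (_∈_; _∉_; mapWith∈)
open import Data.List.Membership.Propositional.Properties using (∈-filter⁺; ∈-filter⁻; map-mapWith∈; mapWith∈-id)
open import Data.List.Membership.DecPropositional _≟_ using (_∈?_)
import Data.List.Membership.DecPropositional as DecMembership
open import Data.List.Extrema.Nat using (min; v≤min⁺; min≤⊤; min≤xs)
open import Data.Product using (Σ; _×_; _,_; proj₁; proj₂)
open import Data.Sum using (_⊎_; inj₁; inj₂)
open import Data.Empty using (⊥-elim)
open import Function using (_∘_)
open import Level using (0ℓ)
open import Relation.Nullary using (Dec; yes; no; ¬_; ¬?)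
open import Relation.Nullary.Decidable using (_×-dec_)
open import Relation.Unary using (Pred; Decidable)
open import Relation.Binary.PropositionalEquality

private variable P Q R : Set

𝟙 : Dec P → ℕ
𝟙 (yes _) = 1
𝟙 (no _)  = 0

𝟙-mono : (p : Dec P) (q : Dec Q) → (P → Q) → 𝟙 p ≤ 𝟙 q
𝟙-mono (yes p) (yes _) P⇒Q = ≤-refl
𝟙-mono (yes p) (no ¬q) P⇒Q = ⊥-elim (¬q (P⇒Q p))
𝟙-mono (no _)  q       P⇒Q = z≤n

𝟙-cong : (p : Dec P) (q : Dec Q) → (P → Q) → (Q → P) → 𝟙 p ≡ 𝟙 q
𝟙-cong p q P⇒Q Q⇒P = ≤-antisym (𝟙-mono p q P⇒Q) (𝟙-mono q p Q⇒P)

𝟙-reject : (p : Dec P) → ¬ P → 𝟙 p ≡ 0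
𝟙-reject (yes p) ¬p = ⊥-elim (¬p p)
𝟙-reject (no _)  ¬p = refl

𝟙-accept : (p : Dec P) → P → 𝟙 p ≡ 1
𝟙-accept (yes _) p = refl
𝟙-accept (no ¬p) p = ⊥-elim (¬p p)

𝟙-⊎ : (p : Dec P) (q : Dec Q) (r : Dec R) → (P → Q ⊎ R) → 𝟙 p ≤ 𝟙 q + 𝟙 r
𝟙-⊎ (no _)  q       r       P⇒Q⊎R = z≤n
𝟙-⊎ (yes p) (yes _) r       P⇒Q⊎R = s≤s z≤n
𝟙-⊎ (yes p) (no ¬q) r       P⇒Q⊎R with P⇒Q⊎R p
... | inj₁ q = ⊥-elim (¬q q)
... | inj₂ r′ = ≤-reflexive (sym (𝟙-accept r r′))

𝟙-disjoint : (p : Dec P) (q : Dec Q) (r : Dec R) → (P → R) → (Q → R) → (P → ¬ Q) → 𝟙 p + 𝟙 q ≤ 𝟙 r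
𝟙-disjoint (no _)  q       r P⇒R Q⇒R disj = 𝟙-mono q r Q⇒R
𝟙-disjoint (yes p) (no _)  r P⇒R Q⇒R disj = ≤-reflexive (sym (𝟙-accept r (P⇒R p)))
𝟙-disjoint (yes p) (yes q) r P⇒R Q⇒R disj = ⊥-elim (disj p q)

Σ< : ℕ → (ℕ → ℕ) → ℕ
Σ< N f = ∑.sum {N} (f ∘ toℕ)

Σ<-cong : ∀ N {f g : ℕ → ℕ} → (∀ i → f i ≡ g i) → Σ< N f ≡ Σ< N g
Σ<-cong N f≗g = ∑.sum-cong-≗ {N} (f≗g ∘ toℕ)

Σ<-zero : ∀ N (f : ℕ → ℕ) → (∀ i → f i ≡ 0) → Σ< N f ≡ 0
Σ<-zero N f f≗0 = trans (Σ<-cong N f≗0) (∑.sum-replicate-zero N)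

Σ<-mono-≤ : ∀ N {f g : ℕ → ℕ} → (∀ i → i < N → f i ≤ g i) → Σ< N f ≤ Σ< N g
Σ<-mono-≤ zero    f≤g = z≤n
Σ<-mono-≤ (suc N) f≤g = +-mono-≤ (f≤g 0 z<s) (Σ<-mono-≤ N (λ i i<N → f≤g (suc i) (s<s i<N)))

Σ<-distrib-+ : ∀ N (f g : ℕ → ℕ) → Σ< N (λ i → f i + g i) ≡ Σ< N f + Σ< N g
Σ<-distrib-+ N f g = ∑.∑-distrib-+ {N} (f ∘ toℕ) (g ∘ toℕ)

Σ<-comm : ∀ N M (f : ℕ → ℕ → ℕ) → Σ< N (λ i → Σ< M (f i)) ≡ Σ< M (λ j → Σ< N (λ i → f i j))
Σ<-comm N M f = ∑.∑-comm {N} {M} (λ i j → f (toℕ i) (toℕ j))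

term≤Σ< : ∀ N (f : ℕ → ℕ) i → i < N → f i ≤ Σ< N f
term≤Σ< (suc N) f zero    _         = m≤m+n (f 0) _
term≤Σ< (suc N) f (suc i) (s<s i<N) = ≤-trans (term≤Σ< N (f ∘ suc) i i<N) (m≤n+m _ (f 0))

Σ<-suc : ∀ N (f : ℕ → ℕ) → f N ≡ 0 → Σ< (suc N) f ≡ Σ< N f
Σ<-suc zero    f fN≡0 = cong (_+ 0) fN≡0
Σ<-suc (suc N) f fN≡0 = cong (f 0 +_) (Σ<-suc N (f ∘ suc) fN≡0)

count< : ℕ → {P : Pred ℕ 0ℓ} → Decidable P → ℕ
count< N P? = Σ< N (λ n → 𝟙 (P? n))

module _ (N : ℕ) {P Q : Pred ℕ 0ℓ} (P? : Decidable P) (Q? : Decidable Q) where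

  count<-mono : (∀ n → n < N → P n → Q n) → count< N P? ≤ count< N Q?
  count<-mono P⇒Q = Σ<-mono-≤ N (λ n n<N → 𝟙-mono (P? n) (Q? n) (P⇒Q n n<N))

  count<-cong : (∀ n → P n → Q n) → (∀ n → Q n → P n) → count< N P? ≡ count< N Q?
  count<-cong P⇒Q Q⇒P = Σ<-cong N (λ n → 𝟙-cong (P? n) (Q? n) (P⇒Q n) (Q⇒P n))

count<-< : ∀ N M → count< N (_<? M) ≡ N ⊓ M
count<-< zero    M       = refl
count<-< (suc N) zero    = Σ<-zero N _ (λ n → 𝟙-reject (suc n <? 0) λ ())
count<-< (suc N) (suc M) = cong suc (trans
  (count<-cong N (λ n → suc n <? suc M) (_<? M) (λ _ → s≤s⁻¹) (λ _ → s≤s)) (count<-< N M))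

count<≤N : ∀ N {P : Pred ℕ 0ℓ} (P? : Decidable P) → count< N P? ≤ N
count<≤N N P? = begin
  count< N P?        ≤⟨ count<-mono N P? (_<? N) (λ _ n<N _ → n<N) ⟩
  count< N (_<? N)   ≡⟨ count<-< N N ⟩
  N ⊓ N              ≡⟨ ⊓-idem N ⟩
  N                  ∎
  where open ≤-Reasoning

count<-≟≤1 : ∀ N r → count< N (_≟ r) ≤ 1
count<-≟≤1 zero    r       = z≤n
count<-≟≤1 (suc N) zero    = ≤-reflexive (cong suc (Σ<-zero N _ (λ n → 𝟙-reject (suc n ≟ 0) λ ())))
count<-≟≤1 (suc N) (suc r) = begin
  count< N (λ n → suc n ≟ suc r)
    ≡⟨ count<-cong N (λ n → suc n ≟ suc r) (_≟ r) (λ _ → suc-injective) (λ _ → cong suc) ⟩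
  count< N (_≟ r)
    ≤⟨ count<-≟≤1 N r ⟩
  1 ∎
  where open ≤-Reasoning

count<-∈≤length : ∀ N (R : List ℕ) → count< N (_∈? R) ≤ length R
count<-∈≤length N []      = ≤-reflexive (Σ<-zero N _ (λ n → 𝟙-reject (n ∈? []) λ ()))
count<-∈≤length N (r ∷ R) = begin
  count< N (_∈? (r ∷ R))
    ≤⟨ Σ<-mono-≤ N (λ n _ → 𝟙-⊎ (n ∈? (r ∷ R)) (n ≟ r) (n ∈? R) here-or-there) ⟩
  Σ< N (λ n → 𝟙 (n ≟ r) + 𝟙 (n ∈? R))
    ≡⟨ Σ<-distrib-+ N (λ n → 𝟙 (n ≟ r)) (λ n → 𝟙 (n ∈? R)) ⟩
  count< N (_≟ r) + count< N (_∈? R)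
    ≤⟨ +-mono-≤ (count<-≟≤1 N r) (count<-∈≤length N R) ⟩
  suc (length R) ∎
  where
  open ≤-Reasoning
  here-or-there : ∀ {n} → n ∈ r ∷ R → n ≡ r ⊎ n ∈ R
  here-or-there (here n≡r) = inj₁ n≡r
  here-or-there (there n∈R) = inj₂ n∈R

count<-⊆⋂ : ∀ N T (Rs : List (List ℕ)) {P : Pred ℕ 0ℓ} (P? : Decidable P) →
  (∀ n → n < N → P n → n < T × All (n ∈_) Rs) → count< N P? ≤ min T (map length Rs)
count<-⊆⋂ N T Rs P? P⊆⋂ = v≤min⁺ #P≤T (map⁺ (All.tabulate #P≤|R|))
  where
  open ≤-Reasoning
  #P≤T : count< N P? ≤ T
  #P≤T = begin
    count< N P?       ≤⟨ count<-mono N P? (_<? T) (λ n n<N → proj₁ ∘ P⊆⋂ n n<N) ⟩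
    count< N (_<? T)  ≡⟨ count<-< N T ⟩
    N ⊓ T             ≤⟨ m⊓n≤n N T ⟩
    T                 ∎
  #P≤|R| : ∀ {R} → R ∈ Rs → count< N P? ≤ length R
  #P≤|R| {R} R∈Rs = begin
    count< N P?       ≤⟨ count<-mono N P? (_∈? R) (λ n n<N Pn → All.lookup (proj₂ (P⊆⋂ n n<N Pn)) R∈Rs) ⟩
    count< N (_∈? R)  ≤⟨ count<-∈≤length N R ⟩
    length R          ∎

count<-≤-⊇prefix : ∀ N M {P Q : Pred ℕ 0ℓ} (P? : Decidable P) (Q? : Decidable Q) →
  count< N P? ≤ M → (∀ n → n < N → n < M → Q n) → count< N P? ≤ count< N Q?
count<-≤-⊇prefix N M P? Q? #P≤M prefix⊆Q = begin
  count< N P?       ≤⟨ ⊓-glb (count<≤N N P?) #P≤M ⟩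
  N ⊓ M             ≡⟨ count<-< N M ⟨
  count< N (_<? M)  ≤⟨ count<-mono N (_<? M) Q? prefix⊆Q ⟩
  count< N Q?       ∎
  where open ≤-Reasoning

-- A set inside [0,T) ∩ ⋂ Rs has at most min(T, |R| : R ∈ Rs) elements, which is the size of the
-- initial segment that the second hypothesis places inside Q.
count<-⋂≤prefix : ∀ N T (Rs : List (List ℕ)) {P Q : Pred ℕ 0ℓ} (P? : Decidable P) (Q? : Decidable Q) →
  (∀ n → n < N → P n → n < T × All (n ∈_) Rs) →
  (∀ n → n < N → n < T → All (λ R → n < length R) Rs → Q n) →
  count< N P? ≤ count< N Q?
count<-⋂≤prefix N T Rs P? Q? P⊆⋂ prefix⊆Q =
  count<-≤-⊇prefix N μ P? Q? (count<-⊆⋂ N T Rs P? P⊆⋂) λ n n<N n<μ →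
    prefix⊆Q n n<N (<-≤-trans n<μ (min≤⊤ T (map length Rs)))
                   (map⁻ (All.map (<-≤-trans n<μ) (min≤xs T (map length Rs))))
  where μ = min T (map length Rs)

Σbox : ℕ → (d : ℕ) → (Vec ℕ d → ℕ) → ℕ
Σbox k zero    f = f []
Σbox k (suc d) f = Σ< (suc k) (λ n → Σbox k d (λ x → f (x ∷ʳ n)))

countBox : ℕ → (d : ℕ) → {P : Pred (Vec ℕ d) 0ℓ} → Decidable P → ℕ
countBox k d P? = Σbox k d (λ a → 𝟙 (P? a))

module _ (k : ℕ) where

  Σbox-cong : ∀ d {f g : Vec ℕ d → ℕ} → (∀ a → f a ≡ g a) → Σbox k d f ≡ Σbox k d g
  Σbox-cong zero    f≗g = f≗g []
  Σbox-cong (suc d) f≗g = Σ<-cong (suc k) (λ n → Σbox-cong d (λ x → f≗g (x ∷ʳ n)))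

  Σbox-mono-≤ : ∀ d {f g : Vec ℕ d → ℕ} → (∀ a → f a ≤ g a) → Σbox k d f ≤ Σbox k d g
  Σbox-mono-≤ zero    f≤g = f≤g []
  Σbox-mono-≤ (suc d) f≤g = Σ<-mono-≤ (suc k) (λ n _ → Σbox-mono-≤ d (λ x → f≤g (x ∷ʳ n)))

  Σbox-zero : ∀ d (f : Vec ℕ d → ℕ) → (∀ a → f a ≡ 0) → Σbox k d f ≡ 0
  Σbox-zero zero    f f≗0 = f≗0 []
  Σbox-zero (suc d) f f≗0 = Σ<-zero (suc k) _ (λ n → Σbox-zero d _ (λ x → f≗0 (x ∷ʳ n)))

  Σbox-distrib-+ : ∀ d (f g : Vec ℕ d → ℕ) → Σbox k d (λ a → f a + g a) ≡ Σbox k d f + Σbox k d g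
  Σbox-distrib-+ zero    f g = refl
  Σbox-distrib-+ (suc d) f g =
    trans (Σ<-cong (suc k) (λ n → Σbox-distrib-+ d (λ x → f (x ∷ʳ n)) (λ x → g (x ∷ʳ n))))
          (Σ<-distrib-+ (suc k) (λ n → Σbox k d (λ x → f (x ∷ʳ n))) (λ n → Σbox k d (λ x → g (x ∷ʳ n))))

  Σ<-Σbox-comm : ∀ d N (f : ℕ → Vec ℕ d → ℕ) →
    Σ< N (λ i → Σbox k d (f i)) ≡ Σbox k d (λ a → Σ< N (λ i → f i a))
  Σ<-Σbox-comm zero    N f = refl
  Σ<-Σbox-comm (suc d) N f = begin
    Σ< N (λ i → Σ< (suc k) (λ n → Σbox k d (λ x → f i (x ∷ʳ n))))
      ≡⟨ Σ<-comm N (suc k) (λ i n → Σbox k d (λ x → f i (x ∷ʳ n))) ⟩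
    Σ< (suc k) (λ n → Σ< N (λ i → Σbox k d (λ x → f i (x ∷ʳ n))))
      ≡⟨ Σ<-cong (suc k) (λ n → Σ<-Σbox-comm d N (λ i x → f i (x ∷ʳ n))) ⟩
    Σ< (suc k) (λ n → Σbox k d (λ x → Σ< N (λ i → f i (x ∷ʳ n)))) ∎
    where open ≡-Reasoning

  Σbox-∷ : ∀ d (f : Vec ℕ (suc d) → ℕ) →
    Σ< (suc k) (λ m → Σbox k d (λ x → f (m ∷ x))) ≡ Σbox k (suc d) f
  Σbox-∷ zero    f = refl
  Σbox-∷ (suc d) f = begin
    Σ< (suc k) (λ m → Σ< (suc k) (λ n → Σbox k d (λ x → f (m ∷ (x ∷ʳ n)))))
      ≡⟨ Σ<-comm (suc k) (suc k) (λ m n → Σbox k d (λ x → f (m ∷ (x ∷ʳ n)))) ⟩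
    Σ< (suc k) (λ n → Σ< (suc k) (λ m → Σbox k d (λ x → f (m ∷ (x ∷ʳ n)))))
      ≡⟨ Σ<-cong (suc k) (λ n → Σbox-∷ d (λ y → f (y ∷ʳ n))) ⟩
    Σ< (suc k) (λ n → Σbox k (suc d) (λ y → f (y ∷ʳ n))) ∎
    where open ≡-Reasoning

∣∷ʳ∣ᵥ : ∀ {d} (x : Vec ℕ d) n → ∣ x ∷ʳ n ∣ᵥ ≡ ∣ x ∣ᵥ + n
∣∷ʳ∣ᵥ []      n = +-identityʳ n
∣∷ʳ∣ᵥ (m ∷ x) n = trans (cong (m +_) (∣∷ʳ∣ᵥ x n)) (sym (+-assoc m _ n))

∣∷ʳ0∣ᵥ : ∀ {d} (x : Vec ℕ d) → ∣ x ∷ʳ 0 ∣ᵥ ≡ ∣ x ∣ᵥ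
∣∷ʳ0∣ᵥ x = trans (∣∷ʳ∣ᵥ x 0) (+-identityʳ _)

term≤Σbox : ∀ k d (f : Vec ℕ d → ℕ) a → ∣ a ∣ᵥ ≤ k → f a ≤ Σbox k d f
term≤Σbox k zero    f []     _     = ≤-refl
term≤Σbox k (suc d) f a |a|≤k with initLast a
... | x , n , refl = ≤-trans
  (term≤Σbox k d (λ y → f (y ∷ʳ n)) x (≤-trans (m≤m+n _ n) |x|+n≤k))
  (term≤Σ< (suc k) (λ m → Σbox k d (λ y → f (y ∷ʳ m))) n (s≤s (≤-trans (m≤n+m n _) |x|+n≤k)))
  where |x|+n≤k = subst (_≤ k) (∣∷ʳ∣ᵥ x n) |a|≤k

sum-map-allVecs : ∀ d k (f : Vec ℕ d → ℕ) → sum (map f (allVecs d k)) ≡ Σbox k d f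
sum-map-allVecs zero    k f = +-identityʳ (f [])
sum-map-allVecs (suc d) k f = begin
  sum (map f (concatMap (λ m → map (m ∷_) (allVecs d k)) (applyUpTo (λ m → m) (suc k))))
    ≡⟨ sum-map-concatMap (λ m → map (m ∷_) (allVecs d k)) (λ m → m) (suc k) ⟩
  Σ< (suc k) (λ m → sum (map f (map (m ∷_) (allVecs d k))))
    ≡⟨ Σ<-cong (suc k) (λ m → trans (cong sum (sym (map-∘ {g = f} {f = m ∷_} (allVecs d k))))
                                   (sum-map-allVecs d k (f ∘ (m ∷_)))) ⟩
  Σ< (suc k) (λ m → Σbox k d (λ x → f (m ∷ x)))
    ≡⟨ Σbox-∷ k d f ⟩
  Σbox k (suc d) f ∎
  where
  open ≡-Reasoning
  sum-map-concatMap : (g : ℕ → List (Vec ℕ (suc d))) (h : ℕ → ℕ) (N : ℕ) →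
    sum (map f (concatMap g (applyUpTo h N))) ≡ Σ< N (λ m → sum (map f (g (h m))))
  sum-map-concatMap g h zero    = refl
  sum-map-concatMap g h (suc N) = begin
    sum (map f (g (h 0) ++ concatMap g (applyUpTo (h ∘ suc) N)))
      ≡⟨ cong sum (map-++ f (g (h 0)) _) ⟩
    sum (map f (g (h 0)) ++ map f (concatMap g (applyUpTo (h ∘ suc) N)))
      ≡⟨ sum-++ (map f (g (h 0))) _ ⟩
    sum (map f (g (h 0))) + sum (map f (concatMap g (applyUpTo (h ∘ suc) N)))
      ≡⟨ cong (_ +_) (sum-map-concatMap g (h ∘ suc) N) ⟩
    Σ< (suc N) (λ m → sum (map f (g (h m)))) ∎

length-filter-filter : ∀ {A : Set} {P Q : Pred A 0ℓ} (P? : Decidable P) (Q? : Decidable Q) xs →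
  length (filter Q? (filter P? xs)) ≡ sum (map (λ x → 𝟙 (P? x ×-dec Q? x)) xs)
length-filter-filter P? Q? [] = refl
length-filter-filter P? Q? (x ∷ xs) with P? x
... | no _  = length-filter-filter P? Q? xs
... | yes _ with Q? x
...   | yes _ = cong suc (length-filter-filter P? Q? xs)
...   | no _  = length-filter-filter P? Q? xs

_≟ᵥ_ : ∀ {d} (a b : Vec ℕ d) → Dec (a ≡ b)
_≟ᵥ_ = ≡-dec _≟_

_∈ᵥ?_ : ∀ {d} (a : Vec ℕ d) (A : List (Vec ℕ d)) → Dec (a ∈ A)
_∈ᵥ?_ = DecMembership._∈?_ _≟ᵥ_

length≤countBox : ∀ k d {A : List (Vec ℕ d)} → Unique A → All (λ a → ∣ a ∣ᵥ ≤ k) A →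
  length A ≤ countBox k d (_∈ᵥ? A)
length≤countBox k d {[]}    _             _            = z≤n
length≤countBox k d {x ∷ A} (x∉A ∷ uniqA) (|x|≤k ∷ A≤k) = begin
  1 + length A
    ≤⟨ +-mono-≤ 1≤#x (length≤countBox k d uniqA A≤k) ⟩
  countBox k d (_≟ᵥ x) + countBox k d (_∈ᵥ? A)
    ≡⟨ Σbox-distrib-+ k d _ _ ⟨
  Σbox k d (λ a → 𝟙 (a ≟ᵥ x) + 𝟙 (a ∈ᵥ? A))
    ≤⟨ Σbox-mono-≤ k d (λ a → 𝟙-disjoint (a ≟ᵥ x) (a ∈ᵥ? A) (a ∈ᵥ? (x ∷ A)) here there
                                   (λ { refl x∈A → All.lookup x∉A x∈A refl })) ⟩
  countBox k d (_∈ᵥ? (x ∷ A)) ∎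
  where
  open ≤-Reasoning
  1≤#x : 1 ≤ countBox k d (_≟ᵥ x)
  1≤#x = subst (_≤ countBox k d (_≟ᵥ x)) (𝟙-accept (x ≟ᵥ x) refl) (term≤Σbox k d _ x |x|≤k)

weight≤? : ∀ {d} t → Decidable (λ (a : Vec ℕ d) → ∣ a ∣ᵥ ≤ t)
weight≤? t a = ∣ a ∣ᵥ ≤? t

module _ (k : ℕ) where

  count-weight≤0 : ∀ D → countBox k D (weight≤? 0) ≡ 1
  count-weight≤0 zero    = refl
  count-weight≤0 (suc D) = begin
    countBox k D (λ y → weight≤? 0 (y ∷ʳ 0)) + Σ< k (λ m → countBox k D (λ y → weight≤? 0 (y ∷ʳ suc m)))
      ≡⟨ cong₂ _+_ (Σbox-cong k D (λ y → cong (λ w → 𝟙 (w ≤? 0)) (∣∷ʳ0∣ᵥ y)))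
                   (Σ<-zero k _ λ m → Σbox-zero k D _ λ y →
                      𝟙-reject (weight≤? 0 (y ∷ʳ suc m)) (≤0-∷ʳ-suc y m)) ⟩
    countBox k D (weight≤? 0) + 0
      ≡⟨ cong (_+ 0) (count-weight≤0 D) ⟩
    1 ∎
    where
    open ≡-Reasoning
    ≤0-∷ʳ-suc : ∀ {d} (y : Vec ℕ d) m → ¬ ∣ y ∷ʳ suc m ∣ᵥ ≤ 0
    ≤0-∷ʳ-suc y m w≤0 with subst (_≤ 0) (trans (∣∷ʳ∣ᵥ y (suc m)) (+-suc _ m)) w≤0
    ... | ()

  -- Split off the last coordinate n: the slice n = 0 counts points of weight ≤ t+1 in dimension D,
  -- and the slices n = m+1 (m < k) shift to the points of weight ≤ t; the slice n = k is empty as t < k.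
  count-weight≤-pascal : ∀ D t → t < k →
    countBox k (suc D) (weight≤? (suc t)) ≡ countBox k D (weight≤? (suc t)) + countBox k (suc D) (weight≤? t)
  count-weight≤-pascal D t t<k = cong₂ _+_
    (Σbox-cong k D (λ y → cong (λ w → 𝟙 (w ≤? suc t)) (∣∷ʳ0∣ᵥ y)))
    (begin
      Σ< k (λ m → countBox k D (λ y → weight≤? (suc t) (y ∷ʳ suc m)))
        ≡⟨ Σ<-cong k (λ m → Σbox-cong k D (λ y → shift y m)) ⟩
      Σ< k (λ m → countBox k D (λ y → weight≤? t (y ∷ʳ m)))
        ≡⟨ Σ<-suc k (λ m → countBox k D (λ y → weight≤? t (y ∷ʳ m))) last-slice-empty ⟨
      countBox k (suc D) (weight≤? t) ∎)
    where
    open ≡-Reasoning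
    shift : ∀ y m → 𝟙 (weight≤? (suc t) (y ∷ʳ suc m)) ≡ 𝟙 (weight≤? t (y ∷ʳ m))
    shift y m = trans
      (cong (λ w → 𝟙 (w ≤? suc t))
            (trans (∣∷ʳ∣ᵥ y (suc m)) (trans (+-suc _ m) (cong suc (sym (∣∷ʳ∣ᵥ y m))))))
      (𝟙-cong (suc _ ≤? suc t) (_ ≤? t) s≤s⁻¹ s≤s)
    last-slice-empty : countBox k D (λ y → weight≤? t (y ∷ʳ k)) ≡ 0
    last-slice-empty = Σbox-zero k D _ λ y → 𝟙-reject (weight≤? t (y ∷ʳ k)) λ w≤t →
      <⇒≱ t<k (≤-trans (m≤n+m k _) (subst (_≤ t) (∣∷ʳ∣ᵥ y k) w≤t))

  count-weight≤ : ∀ D t → t ≤ k → countBox k D (weight≤? t) ≡ (D + t) C t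
  count-weight≤ zero    t       _   = trans (𝟙-accept (0 ≤? t) z≤n) (sym (nCn≡1 t))
  count-weight≤ (suc D) zero    _   = count-weight≤0 (suc D)
  count-weight≤ (suc D) (suc t) t<k = begin
    countBox k (suc D) (weight≤? (suc t))
      ≡⟨ count-weight≤-pascal D t t<k ⟩
    countBox k D (weight≤? (suc t)) + countBox k (suc D) (weight≤? t)
      ≡⟨ cong₂ _+_ (count-weight≤ D (suc t) t<k) (count-weight≤ (suc D) t (<⇒≤ t<k)) ⟩
    (D + suc t) C suc t + (suc D + t) C t
      ≡⟨ cong (λ n → (D + suc t) C suc t + n C t) (+-suc D t) ⟨
    (D + suc t) C suc t + (D + suc t) C t
      ≡⟨ +-comm ((D + suc t) C suc t) ((D + suc t) C t) ⟩
    (D + suc t) C t + (D + suc t) C suc t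
      ≡⟨ nCk+nC[k+1]≡[n+1]C[k+1] (D + suc t) t ⟩
    (suc D + suc t) C suc t ∎
    where open ≡-Reasoning

⪯-∷ʳ⁻ : ∀ {d} {y x : Vec ℕ d} {m n} → (y ∷ʳ m) ⪯ (x ∷ʳ n) → y ⪯ x × m ≤ n
⪯-∷ʳ⁻ {y = []}    {[]}    (m≤n ∷ []) = [] , m≤n
⪯-∷ʳ⁻ {y = _ ∷ _} {_ ∷ _} (h ∷ hs)   = (h ∷ proj₁ (⪯-∷ʳ⁻ hs)) , proj₂ (⪯-∷ʳ⁻ hs)

⪯-init-last : ∀ {d} (b : Vec ℕ (suc d)) {x n} → b ⪯ (x ∷ʳ n) → init b ⪯ x × last b ≤ n
⪯-init-last b b⪯ = ⪯-∷ʳ⁻ (subst (_⪯ _) (proj₂ (proj₂ (initLast b))) b⪯)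

⪯-head : ∀ {b : Vec ℕ 1} {n} → b ⪯ (n ∷ []) → head b ≤ n
⪯-head (b≤n ∷ []) = b≤n

size-elems : ∀ {k m} (R : SubsetOfSize k m) → length (elems R) ≡ m
size-elems (_ , _ , _ , |R|≡m) = |R|≡m

Good-∷ʳ : ∀ {k d b R f} x n → Good k (suc d) b (R , f) (x ∷ʳ n) →
  (n≤k : n ≤ k) (n∉R : n ∉ elems R) → Good k d (init b) (f n n≤k n∉R) x
Good-∷ʳ x n good n≤k n∉R with last (x ∷ʳ n) | last-∷ʳ n x | init (x ∷ʳ n) | init-∷ʳ n x
... | .n | refl | .x | refl = good n≤k n∉R

Constraint : ℕ → ℕ → Set
Constraint k d = Σ (Vec ℕ (suc d)) (Family k d)

vectors : ∀ {k d} → List (Constraint k d) → List (Vec ℕ (suc d))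
vectors = map proj₁

lastSet : ∀ {k d} → Constraint k (suc d) → List ℕ
lastSet (_ , R , _) = elems R

AllGood : ∀ {k d} → List (Constraint k d) → Vec ℕ (suc d) → Set
AllGood {k} {d} cs a = All (λ c → Good k d (proj₁ c) (proj₂ c) a) cs

Uncovered : ∀ {d} → ℕ → List (Vec ℕ d) → Vec ℕ d → Set
Uncovered S bs a = ∣ a ∣ᵥ < S × All (λ b → ¬ b ⪯ a) bs

uncovered? : ∀ {d} S bs → Decidable (Uncovered {d} S bs)
uncovered? S bs a = (∣ a ∣ᵥ <? S) ×-dec all? (λ b → ¬? (decidable _≤?_ b a)) bs

-- The constraints seen by the hyperplane a_d = n; those with n ∈ R_{d;b} impose nothing there.
-- For n > k, where the families are undefined, nothing is kept.
slice : ∀ {k d} → ℕ → List (Constraint k (suc d)) → List (Constraint k d)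
slice         n []                  = []
slice {k} {d} n ((b , R , f) ∷ cs) with n ≤? k | n ∈? elems R
... | yes n≤k | no n∉R = (init b , f n n≤k n∉R) ∷ slice n cs
... | _       | _      = slice n cs

AllGood-slice : ∀ {k d} n (x : Vec ℕ (suc d)) (cs : List (Constraint k (suc d))) →
  n ≤ k → AllGood cs (x ∷ʳ n) → AllGood (slice n cs) x
AllGood-slice {k} n x []                 n≤k [] = []
AllGood-slice {k} n x ((b , R , f) ∷ cs) n≤k (good ∷ goods) with n ≤? k | n ∈? elems R
... | yes n≤k′ | no n∉R = Good-∷ʳ {b = b} {R} {f} x n good n≤k′ n∉R ∷ AllGood-slice n x cs n≤k goods
... | yes _    | yes _  = AllGood-slice n x cs n≤k goods
... | no n≰k   | _      = ⊥-elim (n≰k n≤k)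

uncovered-slice⇒∈lastSet : ∀ {k d} n (x : Vec ℕ (suc d)) (cs : List (Constraint k (suc d))) →
  n ≤ k → All (λ b → ¬ b ⪯ x) (vectors (slice n cs)) →
  All (λ c → init (proj₁ c) ⪯ x → n ∈ lastSet c) cs
uncovered-slice⇒∈lastSet {k} n x []                 n≤k _ = []
uncovered-slice⇒∈lastSet {k} n x ((b , R , f) ∷ cs) n≤k free with n ≤? k | n ∈? elems R
... | yes _  | yes n∈R = (λ _ → n∈R) ∷ uncovered-slice⇒∈lastSet n x cs n≤k free
... | yes _  | no _    =
  (λ b⪯x → ⊥-elim (All.head free b⪯x)) ∷ uncovered-slice⇒∈lastSet n x cs n≤k (All.tail free)
... | no n≰k | _       = ⊥-elim (n≰k n≤k)

module _ {A : Set} {P Q : Pred A 0ℓ} (P? : Decidable P) {xs : List A} where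

  guarded⇒filter : All (λ x → P x → Q x) xs → All Q (filter P? xs)
  guarded⇒filter h = All.tabulate λ x∈ → let x∈xs , Px = ∈-filter⁻ P? x∈ in All.lookup h x∈xs Px

  filter⇒guarded : All Q (filter P? xs) → All (λ x → P x → Q x) xs
  filter⇒guarded h = All.tabulate λ x∈xs Px → All.lookup h (∈-filter⁺ P? x∈xs Px)

<∸⇒+< : ∀ a n S → a < S ∸ n → a + n < S
<∸⇒+< a n S a<S∸n = m≤o∸n⇒m+n≤o (suc a) n≤S a<S∸n
  where n≤S = <⇒≤ (m∸n≢0⇒n<m λ S∸n≡0 → n≮0 (subst (a <_) S∸n≡0 a<S∸n))

<∸-swap : ∀ a n S → a < S ∸ n → n < S ∸ a
<∸-swap a n S a<S∸n = m+n≤o⇒m≤o∸n (suc n) (subst (_< S) (+-comm a n) (<∸⇒+< a n S a<S∸n))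

count-uncovered-slices≤fibre : ∀ {k d} S (cs : List (Constraint k (suc d))) (x : Vec ℕ (suc d)) →
  count< (suc k) (λ n → uncovered? (S ∸ n) (vectors (slice n cs)) x) ≤
  count< (suc k) (λ n → uncovered? S (vectors cs) (x ∷ʳ n))
count-uncovered-slices≤fibre {k} {d} S cs x =
  count<-⋂≤prefix (suc k) (S ∸ ∣ x ∣ᵥ) (map lastSet (filter relevant? cs))
    (λ n → uncovered? (S ∸ n) (vectors (slice n cs)) x) (λ n → uncovered? S (vectors cs) (x ∷ʳ n))
    (λ n n≤k (|x|<S∸n , free) → <∸-swap ∣ x ∣ᵥ n S |x|<S∸n ,
       map⁺ (guarded⇒filter relevant? (uncovered-slice⇒∈lastSet n x cs (s≤s⁻¹ n≤k) free)))
    (λ n _ n<S∸|x| n<|R| →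
       subst (_< S) (sym (∣∷ʳ∣ᵥ x n)) (<∸⇒+< ∣ x ∣ᵥ n S (<∸-swap n ∣ x ∣ᵥ S n<S∸|x|)) ,
       map⁺ {f = proj₁} (All.map (λ {c} → uncovered-∷ʳ c)
                                 (filter⇒guarded relevant? (map⁻ {f = lastSet} n<|R|))))
  where
  relevant? : Decidable (λ (c : Constraint k (suc d)) → init (proj₁ c) ⪯ x)
  relevant? c = decidable _≤?_ (init (proj₁ c)) x
  uncovered-∷ʳ : ∀ (c : Constraint k (suc d)) {n} →
    (init (proj₁ c) ⪯ x → n < length (lastSet c)) → ¬ proj₁ c ⪯ (x ∷ʳ n)
  uncovered-∷ʳ (b , R , _) n<|R| b⪯ =
    let init⪯ , last≤n = ⪯-init-last b b⪯ in <⇒≱ (subst (_ <_) (size-elems R) (n<|R| init⪯)) last≤n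

count-good≤count-uncovered : ∀ {k} d S (cs : List (Constraint k d))
  {P : Pred (Vec ℕ (suc d)) 0ℓ} (P? : Decidable P) →
  (∀ a → P a → ∣ a ∣ᵥ < S × AllGood cs a) →
  countBox k (suc d) P? ≤ countBox k (suc d) (uncovered? S (vectors cs))
count-good≤count-uncovered {k} zero S cs P? P⇒good =
  count<-⋂≤prefix (suc k) S (map (elems ∘ proj₂) cs)
    (λ n → P? (n ∷ [])) (λ n → uncovered? S (vectors cs) (n ∷ []))
    (λ n _ Pn → let |n|<S , goods = P⇒good (n ∷ []) Pn in
       subst (_< S) (+-identityʳ n) |n|<S , map⁺ goods)
    (λ n _ n<S n<|R| → subst (_< S) (sym (+-identityʳ n)) n<S ,
       map⁺ {f = proj₁} (All.map (λ {c} → uncovered-[] c) (map⁻ {f = elems ∘ proj₂} n<|R|)))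
  where
  uncovered-[] : ∀ (c : Constraint k 0) {n} → n < length (elems (proj₂ c)) → ¬ proj₁ c ⪯ (n ∷ [])
  uncovered-[] (_ , R) n<|R| b⪯ = <⇒≱ (subst (_ <_) (size-elems R) n<|R|) (⪯-head b⪯)
count-good≤count-uncovered {k} (suc d) S cs P? P⇒good = begin
  Σ< (suc k) (λ n → countBox k (suc d) (λ x → P? (x ∷ʳ n)))
    ≤⟨ Σ<-mono-≤ (suc k) (λ n n≤k →
         count-good≤count-uncovered d (S ∸ n) (slice n cs) (λ x → P? (x ∷ʳ n)) λ x Px∷ʳn →
         let |x∷ʳn|<S , goods = P⇒good (x ∷ʳ n) Px∷ʳn in
         +<⇒<∸ (subst (_< S) (∣∷ʳ∣ᵥ x n) |x∷ʳn|<S) , AllGood-slice n x cs (s≤s⁻¹ n≤k) goods) ⟩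
  Σ< (suc k) (λ n → countBox k (suc d) (uncovered? (S ∸ n) (vectors (slice n cs))))
    ≡⟨ Σ<-Σbox-comm k (suc d) (suc k) (λ n x → 𝟙 (uncovered? (S ∸ n) (vectors (slice n cs)) x)) ⟩
  Σbox k (suc d) (λ x → count< (suc k) (λ n → uncovered? (S ∸ n) (vectors (slice n cs)) x))
    ≤⟨ Σbox-mono-≤ k (suc d) (count-uncovered-slices≤fibre S cs) ⟩
  Σbox k (suc d) (λ x → count< (suc k) (λ n → uncovered? S (vectors cs) (x ∷ʳ n)))
    ≡⟨ Σ<-Σbox-comm k (suc d) (suc k) (λ n x → 𝟙 (uncovered? S (vectors cs) (x ∷ʳ n))) ⟨
  countBox k (suc (suc d)) (uncovered? S (vectors cs)) ∎
  where
  open ≤-Reasoning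
  +<⇒<∸ : ∀ {a n} → a + n < S → a < S ∸ n
  +<⇒<∸ {a} = m+n≤o⇒m≤o∸n (suc a)

All-mapWith∈ : ∀ {A B : Set} {P : Pred B 0ℓ} (xs : List A) (f : ∀ {x} → x ∈ xs → B) →
  (∀ {x} (x∈xs : x ∈ xs) → P (f x∈xs)) → All P (mapWith∈ xs f)
All-mapWith∈ []       f Pf = []
All-mapWith∈ (x ∷ xs) f Pf = Pf (here refl) ∷ All-mapWith∈ xs (f ∘ there) (Pf ∘ there)

∣replicate0∣ᵥ : ∀ d → ∣ replicate d 0 ∣ᵥ ≡ 0
∣replicate0∣ᵥ zero    = refl
∣replicate0∣ᵥ (suc d) = ∣replicate0∣ᵥ d

InS0⇒weight≤ : ∀ {d k} {a : Vec ℕ d} → InS0 k a → ∣ a ∣ᵥ ≤ k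
InS0⇒weight≤     (inj₁ (_ , |a|≤k)) = |a|≤k
InS0⇒weight≤ {d} (inj₂ refl)        = subst (_≤ _) (sym (∣replicate0∣ᵥ d)) z≤n

count-uncovered+|upset|≤binomial : ∀ d k (B : List (Vec ℕ d)) →
  countBox k d (uncovered? (suc k) B) + length (Bplus d k B) ≤ (d + k) C k
count-uncovered+|upset|≤binomial d k B = begin
  countBox k d (uncovered? (suc k) B) + length (Bplus d k B)
    ≡⟨ cong (countBox k d (uncovered? (suc k) B) +_)
            (trans (length-filter-filter inSk? above? (allVecs d k)) (sum-map-allVecs d k _)) ⟩
  countBox k d (uncovered? (suc k) B) + countBox k d (λ a → inSk? a ×-dec above? a)
    ≡⟨ Σbox-distrib-+ k d (λ a → 𝟙 (uncovered? (suc k) B a)) (λ a → 𝟙 (inSk? a ×-dec above? a)) ⟨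
  Σbox k d (λ a → 𝟙 (uncovered? (suc k) B a) + 𝟙 (inSk? a ×-dec above? a))
    ≤⟨ Σbox-mono-≤ k d (λ a → 𝟙-disjoint (uncovered? (suc k) B a) (inSk? a ×-dec above? a) (weight≤? k a)
                                (s≤s⁻¹ ∘ proj₁) (proj₂ ∘ proj₁)
                                (λ (_ , free) (_ , dominated) → All¬⇒¬Any free dominated)) ⟩
  countBox k d (weight≤? k)
    ≡⟨ count-weight≤ k d k ≤-refl ⟩
  (d + k) C k ∎
  where
  open ≤-Reasoning
  inSk? : Decidable (InS {d} k)
  inSk? a = (1 ≤? ∣ a ∣ᵥ) ×-dec (∣ a ∣ᵥ ≤? k)
  above? : Decidable (λ a → Any (_⪯ a) B)
  above? a = any? (λ b → decidable _≤?_ b a) B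

lemma10p5 : (d k : ℕ) → 1 ≤ k →
    (A B : List (Vec ℕ (suc d))) →
    Unique A → Unique B →
    All (InS0 k) A → All (InS0 k) B →
    (F : (b : Vec ℕ (suc d)) → b ∈ B → Family k d b) →
    ((a b : Vec ℕ (suc d)) → a ∈ A → (b∈B : b ∈ B) → Good k d b (F b b∈B) a) →
    length A ≤ (nd (suc d) k + 1) ∸ length (Bplus (suc d) k B)
lemma10p5 d k _ A B uniqueA _ A⊆S₀ _ F good = begin
  length A
    ≤⟨ length≤countBox k (suc d) uniqueA (All.map InS0⇒weight≤ A⊆S₀) ⟩
  countBox k (suc d) (_∈ᵥ? A)
    ≤⟨ count-good≤count-uncovered d (suc k) cs (_∈ᵥ? A) (λ a a∈A →
         s≤s (InS0⇒weight≤ (All.lookup A⊆S₀ a∈A)) , All-mapWith∈ B _ (good a _ a∈A)) ⟩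
  countBox k (suc d) (uncovered? (suc k) (vectors cs))
    ≡⟨ cong (λ bs → countBox k (suc d) (uncovered? (suc k) bs)) vectors-cs ⟩
  countBox k (suc d) (uncovered? (suc k) B)
    ≤⟨ m+n≤o⇒m≤o∸n (countBox k (suc d) (uncovered? (suc k) B))
                   (count-uncovered+|upset|≤binomial (suc d) k B) ⟩
  (suc d + k) C k ∸ length B⁺
    ≤⟨ ∸-monoˡ-≤ (length B⁺) (≤-trans (m≤n+m∸n ((suc d + k) C k) 1) (≤-reflexive (+-comm 1 _))) ⟩
  (nd (suc d) k + 1) ∸ length B⁺ ∎
  where
  open ≤-Reasoning
  B⁺ : List (Vec ℕ (suc d))
  B⁺ = Bplus (suc d) k B
  cs : List (Constraint k d)
  cs = mapWith∈ B (λ {b} b∈B → b , F b b∈B)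
  vectors-cs : vectors cs ≡ B
  vectors-cs = trans (map-mapWith∈ B _ proj₁) (mapWith∈-id B)
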